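{- For a down-up permutation $\sigma=\sigma_1\cdots\sigma_n\in\mathrm{Alt}_n$, $\hat\imath(\sigma)$ equals $\lfloor n^2/4\rfloor$ plus the number of pairs of indices $i<j$ such that $\sigma_{i+1}<\sigma_j<\sigma_i$.
   Context: $\mathrm{Alt}_n$ is the set of $\sigma\in\mathfrak S_n$ with $\sigma_1>\sigma_2<\sigma_3>\cdots$. $\hat\imath(\sigma)=\sum_{i=1}^{n-1}\hat c_i(\sigma)$, where $\hat c_i(\sigma)$ is the number of $j>i$ with $\sigma_i>\sigma_j$ if $i$ is odd, and the number of $j>i$ with $\sigma_i<\sigma_j$ if $i$ is even. -}

module Defs where

open import Data.Nat using (ℕ; zero; suc; _+_; _*_; _<_; _/_; _<?_)
open import Data.Nat.Properties using (_≟_)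
open import Data.Fin using (Fin; toℕ)
open import Data.List using (List; length; filter; allFin; cartesianProduct)
open import Data.Product using (_×_; _,_; proj₁; proj₂)
open import Data.Sum using (_⊎_)
open import Relation.Nullary using (Dec; yes; no)
open import Relation.Nullary.Decidable using (_×-dec_)
open import Relation.Unary using (Decidable)
open import Function.Bundles using (_↔_; Inverse)
open import Relation.Binary.PropositionalEquality using (_≡_)
open import Data.Nat using (_%_)
open import Data.List using (map)
open import Data.Nat.ListAction using (sum)

-- Positions and values are 0-based (Fin n); position p corresponds to the
-- 1-based index p+1, value v to the 1-based value v+1.
-- parity: the position p (0-based) is even iff p % 2 ≡ 0
Even : ℕ → Set
Even m = m % 2 ≡ 0

Odd : ℕ → Set
Odd m = m % 2 ≡ 1

even? : (m : ℕ) → Dec (Even m)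
even? m = m % 2 ≟ 0

Perm : ℕ → Set
Perm n = Fin n ↔ Fin n

val : ∀ {n} → Perm n → Fin n → ℕ
val σ p = toℕ (Inverse.to σ p)

count : ∀ {A : Set} {P : A → Set} → Decidable P → List A → ℕ
count P? xs = length (filter P? xs)

-- Down-up (alternating) permutations: σ₁ > σ₂ < σ₃ > ⋯
-- For consecutive 0-based positions p, p+1: if p is even (1-based index odd)
-- then σ(p) > σ(p+1), otherwise σ(p) < σ(p+1).
IsAlt : ∀ {n} → Perm n → Set
IsAlt {n} σ = ∀ (p q : Fin n) → suc (toℕ p) ≡ toℕ q →
  (Even (toℕ p) → val σ q < val σ p) × (Odd (toℕ p) → val σ p < val σ q)

-- ĉ_i(σ) for 0-based position p (1-based i = p+1):
--   i odd  (p even): #{ j > i : σ_i > σ_j }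
--   i even (p odd) : #{ j > i : σ_i < σ_j }
chat : ∀ {n} → Perm n → Fin n → ℕ
chat {n} σ p with even? (toℕ p)
... | yes _ = count (λ q → (toℕ p <? toℕ q) ×-dec (val σ q <? val σ p)) (allFin n)
... | no  _ = count (λ q → (toℕ p <? toℕ q) ×-dec (val σ p <? val σ q)) (allFin n)

-- î(σ) = Σ_{i=1}^{n-1} ĉ_i(σ)   (0-based positions p with p + 1 < n)
ihat : ∀ {n} → Perm n → ℕ
ihat {n} σ = sum (map (chat σ) (filter (λ p → suc (toℕ p) <? n) (allFin n)))

-- number of pairs of 1-based indices i < j (with i+1 ≤ n) such that
-- σ_{i+1} < σ_j < σ_i.  In 0-based positions: p < q, p+1 < n, and
-- σ(p+1) < σ(q) < σ(p).  Here r is the position p+1.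
pairCount : ∀ {n} → Perm n → ℕ
pairCount {n} σ =
  count (λ { ((p , r) , q) →
              (suc (toℕ p) ≟ toℕ r) ×-dec ((toℕ p <? toℕ q)
                ×-dec ((val σ r <? val σ q) ×-dec (val σ q <? val σ p))) })
        (cartesianProduct (cartesianProduct (allFin n) (allFin n)) (allFin n))

module Submission where

-- Write f for the sequence of values of σ (0-based positions).
-- Group the positions in consecutive blocks {m, m+1} with m even; at such a
-- block the alternating condition gives a descent f(m+1) < f(m).  For every
-- later position q > m+1 at least one of  f q < f m,  f(m+1) < f q  holds,
-- so  ĉ_m + ĉ_{m+1} = #{q > m} + #{q > m : f(m+1) < f q < f m},  the q = m+1
-- term contributing to #{q > m} through ĉ_m alone.  At the odd position m+1
-- there is an ascent, so it carries no pair  f(m+2) < f q < f(m+1).  Summing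
-- over the blocks, the counts #{q > m} = n-1-m  (m even) add up to ⌊n²/4⌋.

open import Defs
open import Data.Nat using (ℕ; zero; suc; _+_; _*_; _/_; _<_; _≤_; _<?_; _∸_; s≤s; z<s)
open import Data.Nat.Properties
open import Data.Nat.DivMod using (+-distrib-/-∣ʳ; m*n/n≡m; m*n%n≡0; [m+kn]%n≡m%n)
open import Data.Nat.Divisibility using (divides-refl)
open import Data.Fin using (Fin; toℕ; fromℕ<) renaming (zero to fzero; suc to fsuc)
open import Data.Fin.Properties using (toℕ<n; fromℕ<-toℕ; toℕ-fromℕ<)
open import Data.List using (List; []; _∷_; map; filter; allFin; tabulate; cartesianProduct; _++_)
open import Data.List.Properties using (map-++; map-∘; map-tabulate)
open import Data.Nat.ListAction using (sum)
open import Data.Nat.ListAction.Properties using (sum-++)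
open import Data.Product using (_×_; _,_; proj₁; proj₂)
open import Relation.Nullary using (Dec; yes; no; ¬_)
open import Relation.Nullary.Decidable using (_×-dec_)
open import Relation.Unary using (Decidable)
open import Data.Empty using (⊥-elim)
open import Relation.Binary.PropositionalEquality
open import Data.Nat.Solver using (module +-*-Solver)
open +-*-Solver using (solve; _:+_; _:*_; _:=_; con)

𝟙 : ∀ {P : Set} → Dec P → ℕ
𝟙 (yes _) = 1
𝟙 (no _)  = 0

𝟙-yes : ∀ {P : Set} (d : Dec P) → P → 𝟙 d ≡ 1
𝟙-yes (yes _) _ = refl
𝟙-yes (no ¬p) p = ⊥-elim (¬p p)

𝟙-no : ∀ {P : Set} (d : Dec P) → ¬ P → 𝟙 d ≡ 0
𝟙-no (yes p) ¬p = ⊥-elim (¬p p)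
𝟙-no (no _)  _  = refl

𝟙-× : ∀ {P Q : Set} (a : Dec P) (b : Dec Q) → 𝟙 (a ×-dec b) ≡ 𝟙 a * 𝟙 b
𝟙-× (yes _) (yes _) = refl
𝟙-× (yes _) (no _)  = refl
𝟙-× (no _)  (yes _) = refl
𝟙-× (no _)  (no _)  = refl

sumFrom : ℕ → ℕ → (ℕ → ℕ) → ℕ
sumFrom m zero    h = 0
sumFrom m (suc k) h = h m + sumFrom (suc m) k h

sumFrom-cong : ∀ m k {h g : ℕ → ℕ} →
  (∀ p → m ≤ p → p < m + k → h p ≡ g p) → sumFrom m k h ≡ sumFrom m k g
sumFrom-cong m zero    e = refl
sumFrom-cong m (suc k) e = cong₂ _+_ (e m ≤-refl (m<m+n m z<s))
  (sumFrom-cong (suc m) k (λ p m<p p<end → e p (<⇒≤ m<p) (subst (p <_) (sym (+-suc m k)) p<end)))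

sumFrom-vanish : ∀ m k {h : ℕ → ℕ} →
  (∀ p → m ≤ p → p < m + k → h p ≡ 0) → sumFrom m k h ≡ 0
sumFrom-vanish m zero    e = refl
sumFrom-vanish m (suc k) e = cong₂ _+_ (e m ≤-refl (m<m+n m z<s))
  (sumFrom-vanish (suc m) k (λ p m<p p<end → e p (<⇒≤ m<p) (subst (p <_) (sym (+-suc m k)) p<end)))

sumFrom-one : ∀ m k → sumFrom m k (λ _ → 1) ≡ k
sumFrom-one m zero    = refl
sumFrom-one m (suc k) = cong suc (sumFrom-one (suc m) k)

sumFrom-+ : ∀ m k (g h : ℕ → ℕ) → sumFrom m k (λ p → g p + h p) ≡ sumFrom m k g + sumFrom m k h
sumFrom-+ m zero    g h = refl
sumFrom-+ m (suc k) g h =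
  trans (cong (g m + h m +_) (sumFrom-+ (suc m) k g h)) (interchange (g m) (h m) _ _)
  where
  interchange : ∀ a b c d → (a + b) + (c + d) ≡ (a + c) + (b + d)
  interchange = solve 4 (λ a b c d → (a :+ b) :+ (c :+ d) := (a :+ c) :+ (b :+ d)) refl

sumFrom-*ˡ : ∀ m k c (h : ℕ → ℕ) → sumFrom m k (λ p → c * h p) ≡ c * sumFrom m k h
sumFrom-*ˡ m zero    c h = sym (*-zeroʳ c)
sumFrom-*ˡ m (suc k) c h =
  trans (cong (c * h m +_) (sumFrom-*ˡ (suc m) k c h)) (sym (*-distribˡ-+ c (h m) _))

sumFrom-split : ∀ m j l h → sumFrom m (j + l) h ≡ sumFrom m j h + sumFrom (m + j) l h
sumFrom-split m zero    l h rewrite +-identityʳ m = refl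
sumFrom-split m (suc j) l h rewrite +-suc m j =
  trans (cong (h m +_) (sumFrom-split (suc m) j l h)) (sym (+-assoc (h m) _ _))

sumFrom-delta : ∀ n c (H : ℕ → ℕ) → sumFrom 0 n (λ r → 𝟙 (c ≟ r) * H r) ≡ 𝟙 (c <? n) * H c
sumFrom-delta n c H with c <? n
... | no c≮n = sumFrom-vanish 0 n (λ r _ r<n →
        cong (_* H r) (𝟙-no (c ≟ r) (λ { refl → c≮n r<n })))
... | yes c<n = begin
    sumFrom 0 n F                             ≡⟨ cong (λ k → sumFrom 0 k F) (sym n≡c+1+j) ⟩
    sumFrom 0 (c + suc j) F                   ≡⟨ sumFrom-split 0 c (suc j) F ⟩
    sumFrom 0 c F + (F c + sumFrom (suc c) j F) ≡⟨ cong₂ (λ x y → x + (F c + y)) before after ⟩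
    F c + 0                                   ≡⟨ +-identityʳ (F c) ⟩
    F c                                       ≡⟨ cong (_* H c) (𝟙-yes (c ≟ c) refl) ⟩
    1 * H c                                   ∎
  where
  open ≡-Reasoning
  F : ℕ → ℕ
  F r = 𝟙 (c ≟ r) * H r
  j : ℕ
  j = n ∸ suc c
  n≡c+1+j : c + suc j ≡ n
  n≡c+1+j = trans (+-suc c j) (m+[n∸m]≡n c<n)
  before : sumFrom 0 c F ≡ 0
  before = sumFrom-vanish 0 c (λ r _ r<c → cong (_* H r) (𝟙-no (c ≟ r) (λ c≡r → <-irrefl (sym c≡r) r<c)))
  after : sumFrom (suc c) j F ≡ 0
  after = sumFrom-vanish (suc c) j (λ r c<r _ → cong (_* H r) (𝟙-no (c ≟ r) (λ c≡r → <-irrefl c≡r c<r)))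

count-above : ∀ m j → sumFrom 0 (suc m + j) (λ q → 𝟙 (m <? q)) ≡ j
count-above m j = trans (sumFrom-split 0 (suc m) j _) (cong₂ _+_ below above)
  where
  below : sumFrom 0 (suc m) (λ q → 𝟙 (m <? q)) ≡ 0
  below = sumFrom-vanish 0 (suc m) (λ q _ q≤m → 𝟙-no (m <? q) (λ m<q → <-irrefl refl (<-≤-trans m<q (<⇒≤pred q≤m))))
  above : sumFrom (suc m) j (λ q → 𝟙 (m <? q)) ≡ j
  above = trans (sumFrom-cong (suc m) j (λ q m<q _ → 𝟙-yes (m <? q) m<q)) (sumFrom-one (suc m) j)

sum-tabulate : ∀ k m (g : Fin k → ℕ) (h : ℕ → ℕ) →
  (∀ q → g q ≡ h (m + toℕ q)) → sum (tabulate g) ≡ sumFrom m k h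
sum-tabulate zero    m g h e = refl
sum-tabulate (suc k) m g h e = cong₂ _+_ (trans (e fzero) (cong h (+-identityʳ m)))
  (sum-tabulate k (suc m) (λ q → g (fsuc q)) h (λ q → trans (e (fsuc q)) (cong h (+-suc m (toℕ q)))))

sum-allFin : ∀ n (g : Fin n → ℕ) (h : ℕ → ℕ) →
  (∀ q → g q ≡ h (toℕ q)) → sum (map g (allFin n)) ≡ sumFrom 0 n h
sum-allFin n g h e = trans (cong sum (map-tabulate (λ q → q) g)) (sum-tabulate n 0 g h e)

count≡sum : ∀ {A : Set} {P : A → Set} (P? : Decidable P) xs →
  count P? xs ≡ sum (map (λ x → 𝟙 (P? x)) xs)
count≡sum P? [] = refl
count≡sum P? (x ∷ xs) with P? x
... | yes _ = cong suc (count≡sum P? xs)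
... | no _  = count≡sum P? xs

sum-filter : ∀ {A : Set} {P : A → Set} (P? : Decidable P) (g : A → ℕ) xs →
  sum (map g (filter P? xs)) ≡ sum (map (λ x → 𝟙 (P? x) * g x) xs)
sum-filter P? g [] = refl
sum-filter P? g (x ∷ xs) with P? x
... | yes _ = cong₂ _+_ (sym (+-identityʳ (g x))) (sum-filter P? g xs)
... | no _  = sum-filter P? g xs

sum-cartesianProduct : ∀ {A B : Set} (g : A × B → ℕ) xs (ys : List B) →
  sum (map g (cartesianProduct xs ys)) ≡ sum (map (λ x → sum (map (λ y → g (x , y)) ys)) xs)
sum-cartesianProduct g [] ys = refl
sum-cartesianProduct g (x ∷ xs) ys = begin
    sum (map g (map (x ,_) ys ++ cartesianProduct xs ys))
      ≡⟨ cong sum (map-++ g (map (x ,_) ys) _) ⟩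
    sum (map g (map (x ,_) ys) ++ map g (cartesianProduct xs ys))
      ≡⟨ sum-++ (map g (map (x ,_) ys)) _ ⟩
    sum (map g (map (x ,_) ys)) + sum (map g (cartesianProduct xs ys))
      ≡⟨ cong₂ _+_ (cong sum (sym (map-∘ ys))) (sum-cartesianProduct g xs ys) ⟩
    sum (map (λ y → g (x , y)) ys) + sum (map (λ x → sum (map (λ y → g (x , y)) ys)) xs) ∎
  where open ≡-Reasoning

-- quarterSquare k = (k-1) + (k-3) + ⋯, the sum of #{q > m} over the even
-- positions m of a row of length k.
quarterSquare : ℕ → ℕ
quarterSquare zero          = 0
quarterSquare (suc zero)    = 0
quarterSquare (suc (suc k)) = suc k + quarterSquare k

quarterSquare≡ : ∀ k → quarterSquare k ≡ k * k / 4
quarterSquare≡ zero          = refl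
quarterSquare≡ (suc zero)    = refl
quarterSquare≡ (suc (suc k)) = sym (begin
    suc (suc k) * suc (suc k) / 4
      ≡⟨ cong (_/ 4) (solve 1 (λ k → (con 2 :+ k) :* (con 2 :+ k) := k :* k :+ (con 1 :+ k) :* con 4) refl k) ⟩
    (k * k + suc k * 4) / 4
      ≡⟨ +-distrib-/-∣ʳ (k * k) (divides-refl (suc k)) ⟩
    k * k / 4 + suc k * 4 / 4
      ≡⟨ cong₂ _+_ (sym (quarterSquare≡ k)) (m*n/n≡m (suc k) 4) ⟩
    quarterSquare k + suc k
      ≡⟨ +-comm (quarterSquare k) (suc k) ⟩
    suc k + quarterSquare k ∎)
  where open ≡-Reasoning

module Counts (n : ℕ) (f : ℕ → ℕ) where

  laterBelow laterAbove : ℕ → ℕ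
  laterBelow p = sumFrom 0 n (λ q → 𝟙 (p <? q) * 𝟙 (f q <? f p))
  laterAbove p = sumFrom 0 n (λ q → 𝟙 (p <? q) * 𝟙 (f p <? f q))

  ĉ : ℕ → ℕ
  ĉ p with even? p
  ... | yes _ = laterBelow p
  ... | no _  = laterAbove p

  between : ℕ → ℕ
  between p = sumFrom 0 n (λ q → 𝟙 (p <? q) * (𝟙 (f (suc p) <? f q) * 𝟙 (f q <? f p)))

  guarded : (ℕ → ℕ) → ℕ → ℕ
  guarded h p = 𝟙 (suc p <? n) * h p

  ĉ-even : ∀ p → Even p → ĉ p ≡ laterBelow p
  ĉ-even p e with even? p
  ... | yes _ = refl
  ... | no ¬e = ⊥-elim (¬e e)

  ĉ-odd : ∀ p → Odd p → ĉ p ≡ laterAbove p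
  ĉ-odd p o with even? p
  ... | yes e = ⊥-elim (0≢1+n (trans (sym e) o))
  ... | no _  = refl

  guarded-on : ∀ h p → suc p < n → guarded h p ≡ h p
  guarded-on h p lt rewrite 𝟙-yes (suc p <? n) lt = +-identityʳ (h p)

  guarded-off : ∀ h p → ¬ suc p < n → guarded h p ≡ 0
  guarded-off h p ¬lt rewrite 𝟙-no (suc p <? n) ¬lt = refl

  laterAbove-last : ∀ p → ¬ suc p < n → laterAbove p ≡ 0
  laterAbove-last p ¬lt = sumFrom-vanish 0 n (λ q _ q<n →
    cong (_* 𝟙 (f p <? f q)) (𝟙-no (p <? q) (λ p<q → ¬lt (≤-<-trans p<q q<n))))

  -- Pointwise form of the block identity at a descent f(m+1) < f(m):
  -- for q > m+1 one of f q < f m, f(m+1) < f q holds, and both iff q is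
  -- "between"; for q = m+1 only the first term counts.
  descent-pointwise : ∀ m → f (suc m) < f m → ∀ q →
    𝟙 (m <? q) * 𝟙 (f q <? f m) + 𝟙 (suc m <? q) * 𝟙 (f (suc m) <? f q)
      ≡ 𝟙 (m <? q) + 𝟙 (m <? q) * (𝟙 (f (suc m) <? f q) * 𝟙 (f q <? f m))
  descent-pointwise m desc q with m <? q
  ... | no m≮q rewrite 𝟙-no (suc m <? q) (λ sm<q → m≮q (<-trans (n<1+n m) sm<q)) = refl
  ... | yes m<q with suc m <? q
  ...   | no sm≮q = successor (≤-antisym (≮⇒≥ sm≮q) m<q)
    where
    successor : q ≡ suc m → 1 * 𝟙 (f q <? f m) + 0 * 𝟙 (f (suc m) <? f q)
                              ≡ 1 + 1 * (𝟙 (f (suc m) <? f q) * 𝟙 (f q <? f m))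
    successor refl rewrite 𝟙-yes (f (suc m) <? f m) desc
                         | 𝟙-no (f (suc m) <? f (suc m)) (<-irrefl refl) = refl
  ...   | yes _ with f q <? f m | f (suc m) <? f q
  ...     | yes _   | yes _   = refl
  ...     | yes _   | no _    = refl
  ...     | no _    | yes _   = refl
  ...     | no fq≮fm | no fsm≮fq = ⊥-elim (fsm≮fq (<-≤-trans desc (≮⇒≥ fq≮fm)))

  descent-block : ∀ m j → f (suc m) < f m → suc m + j ≡ n →
    laterBelow m + laterAbove (suc m) ≡ j + between m
  descent-block m j desc e = begin
    laterBelow m + laterAbove (suc m)
      ≡⟨ sym (sumFrom-+ 0 n _ _) ⟩
    sumFrom 0 n (λ q → 𝟙 (m <? q) * 𝟙 (f q <? f m) + 𝟙 (suc m <? q) * 𝟙 (f (suc m) <? f q))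
      ≡⟨ sumFrom-cong 0 n (λ q _ _ → descent-pointwise m desc q) ⟩
    sumFrom 0 n (λ q → 𝟙 (m <? q) + 𝟙 (m <? q) * (𝟙 (f (suc m) <? f q) * 𝟙 (f q <? f m)))
      ≡⟨ sumFrom-+ 0 n _ _ ⟩
    sumFrom 0 n (λ q → 𝟙 (m <? q)) + between m
      ≡⟨ cong (λ k → sumFrom 0 k (λ q → 𝟙 (m <? q)) + between m) (sym e) ⟩
    sumFrom 0 (suc m + j) (λ q → 𝟙 (m <? q)) + between m
      ≡⟨ cong (_+ between m) (count-above m j) ⟩
    j + between m ∎
    where open ≡-Reasoning

  ascent-between : ∀ p → f p < f (suc p) → between p ≡ 0
  ascent-between p asc = sumFrom-vanish 0 n (λ q _ _ → no-pair q)
    where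
    no-pair : ∀ q → 𝟙 (p <? q) * (𝟙 (f (suc p) <? f q) * 𝟙 (f q <? f p)) ≡ 0
    no-pair q with f (suc p) <? f q | f q <? f p
    ... | yes above | yes below = ⊥-elim (<-asym asc (<-trans above below))
    ... | yes _     | no _      = *-zeroʳ (𝟙 (p <? q))
    ... | no _      | _         = *-zeroʳ (𝟙 (p <? q))

  module Alternating
    (descent : ∀ m → suc m < n → Even m → f (suc m) < f m)
    (ascent  : ∀ m → suc m < n → Odd m → f m < f (suc m)) where

    block : ∀ t k → let m = t * 2 in suc (suc m) + k ≡ n →
      guarded ĉ m + guarded ĉ (suc m) ≡ suc k + (guarded between m + guarded between (suc m))
    block t k e = begin
        guarded ĉ m + guarded ĉ (suc m)
          ≡⟨ cong₂ _+_ (trans (guarded-on ĉ m sm<n) (ĉ-even m even-m)) guarded-ĉ-odd ⟩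
        laterBelow m + laterAbove (suc m)
          ≡⟨ descent-block m (suc k) (descent m sm<n even-m) (trans (+-suc (suc m) k) e) ⟩
        suc k + between m
          ≡⟨ cong (suc k +_) (sym guarded-between-block) ⟩
        suc k + (guarded between m + guarded between (suc m)) ∎
      where
      open ≡-Reasoning
      m : ℕ
      m = t * 2
      even-m : Even m
      even-m = m*n%n≡0 t 2
      odd-sm : Odd (suc m)
      odd-sm = [m+kn]%n≡m%n 1 t 2
      sm<n : suc m < n
      sm<n = subst (suc m <_) e (s≤s (s≤s (m≤m+n m k)))
      guarded-ĉ-odd : guarded ĉ (suc m) ≡ laterAbove (suc m)
      guarded-ĉ-odd with suc (suc m) <? n
      ... | yes _    = trans (+-identityʳ _) (ĉ-odd (suc m) odd-sm)
      ... | no ¬last = sym (laterAbove-last (suc m) ¬last)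
      guarded-between-odd : guarded between (suc m) ≡ 0
      guarded-between-odd with suc (suc m) <? n
      ... | yes lt = trans (+-identityʳ _) (ascent-between (suc m) (ascent (suc m) lt odd-sm))
      ... | no _   = refl
      guarded-between-block : guarded between m + guarded between (suc m) ≡ between m
      guarded-between-block =
        trans (cong₂ _+_ (guarded-on between m sm<n) guarded-between-odd) (+-identityʳ (between m))

    blocks : ∀ k t → t * 2 + k ≡ n →
      sumFrom (t * 2) k (guarded ĉ) ≡ quarterSquare k + sumFrom (t * 2) k (guarded between)
    blocks zero t e = refl
    blocks (suc zero) t e = cong (_+ 0) (trans (guarded-off ĉ m last) (sym (guarded-off between m last)))
      where
      m : ℕ
      m = t * 2
      last : ¬ suc m < n
      last lt = <-irrefl (trans (+-comm 1 m) e) lt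
    blocks (suc (suc k)) t e = begin
        guarded ĉ m + (guarded ĉ (suc m) + sumFrom (suc (suc m)) k (guarded ĉ))
          ≡⟨ sym (+-assoc (guarded ĉ m) _ _) ⟩
        (guarded ĉ m + guarded ĉ (suc m)) + sumFrom (suc (suc m)) k (guarded ĉ)
          ≡⟨ cong₂ _+_ (block t k e′) (blocks k (suc t) e′) ⟩
        (suc k + (guarded between m + guarded between (suc m)))
          + (quarterSquare k + sumFrom (suc (suc m)) k (guarded between))
          ≡⟨ regroup (suc k) (guarded between m) (guarded between (suc m)) (quarterSquare k) _ ⟩
        (suc k + quarterSquare k)
          + (guarded between m + (guarded between (suc m) + sumFrom (suc (suc m)) k (guarded between))) ∎
      where
      open ≡-Reasoning
      m : ℕ
      m = t * 2
      e′ : suc (suc m) + k ≡ n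
      e′ = trans (sym (trans (+-suc m (suc k)) (cong suc (+-suc m k)))) e
      regroup : ∀ a b c d s → (a + (b + c)) + (d + s) ≡ (a + d) + (b + (c + s))
      regroup = solve 5 (λ a b c d s → (a :+ (b :+ c)) :+ (d :+ s) := (a :+ d) :+ (b :+ (c :+ s))) refl

module PermutationValues {n : ℕ} (σ : Perm n) where

  values : ℕ → ℕ
  values k with k <? n
  ... | yes k<n = val σ (fromℕ< k<n)
  ... | no _    = 0

  values-val : ∀ q → val σ q ≡ values (toℕ q)
  values-val q with toℕ q <? n
  ... | yes lt  = cong (val σ) (sym (fromℕ<-toℕ q lt))
  ... | no ¬lt  = ⊥-elim (¬lt (toℕ<n q))

  open Counts n values

  module _ (alt : IsAlt σ) (m : ℕ) (sm<n : suc m < n) where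
    private
      m<n : m < n
      m<n = <-trans (n<1+n m) sm<n
      toℕ-m : toℕ (fromℕ< m<n) ≡ m
      toℕ-m = toℕ-fromℕ< m<n
      toℕ-sm : toℕ (fromℕ< sm<n) ≡ suc m
      toℕ-sm = toℕ-fromℕ< sm<n
      value-m : val σ (fromℕ< m<n) ≡ values m
      value-m = trans (values-val _) (cong values toℕ-m)
      value-sm : val σ (fromℕ< sm<n) ≡ values (suc m)
      value-sm = trans (values-val _) (cong values toℕ-sm)
      alt-m : (Even (toℕ (fromℕ< m<n)) → val σ (fromℕ< sm<n) < val σ (fromℕ< m<n))
            × (Odd (toℕ (fromℕ< m<n)) → val σ (fromℕ< m<n) < val σ (fromℕ< sm<n))
      alt-m = alt (fromℕ< m<n) (fromℕ< sm<n) (trans (cong suc toℕ-m) (sym toℕ-sm))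

    values-descent : Even m → values (suc m) < values m
    values-descent e = subst₂ _<_ value-sm value-m (proj₁ alt-m (subst Even (sym toℕ-m) e))

    values-ascent : Odd m → values m < values (suc m)
    values-ascent o = subst₂ _<_ value-m value-sm (proj₂ alt-m (subst Odd (sym toℕ-m) o))

  chat≡ĉ : ∀ q → chat σ q ≡ ĉ (toℕ q)
  chat≡ĉ q with even? (toℕ q)
  ... | yes _ = trans (count≡sum _ (allFin n)) (sum-allFin n _ _ λ r →
          trans (𝟙-× (toℕ q <? toℕ r) (val σ r <? val σ q))
            (cong (𝟙 (toℕ q <? toℕ r) *_) (cong₂ (λ x y → 𝟙 (x <? y)) (values-val r) (values-val q))))
  ... | no _  = trans (count≡sum _ (allFin n)) (sum-allFin n _ _ λ r →
          trans (𝟙-× (toℕ q <? toℕ r) (val σ q <? val σ r))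
            (cong (𝟙 (toℕ q <? toℕ r) *_) (cong₂ (λ x y → 𝟙 (x <? y)) (values-val q) (values-val r))))

  ihat≡ : ihat σ ≡ sumFrom 0 n (guarded ĉ)
  ihat≡ = trans (sum-filter _ (chat σ) (allFin n))
    (sum-allFin n _ (guarded ĉ) (λ q → cong (𝟙 (suc (toℕ q) <? n) *_) (chat≡ĉ q)))

  pairIndicator : Fin n → Fin n → Fin n → ℕ
  pairIndicator p r q = 𝟙 ((suc (toℕ p) ≟ toℕ r) ×-dec ((toℕ p <? toℕ q)
                          ×-dec ((val σ r <? val σ q) ×-dec (val σ q <? val σ p))))

  pairTerm : ℕ → ℕ → ℕ → ℕ
  pairTerm p r q = 𝟙 (p <? q) * (𝟙 (values r <? values q) * 𝟙 (values q <? values p))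

  pairIndicator≡ : ∀ p r q → pairIndicator p r q ≡ 𝟙 (suc (toℕ p) ≟ toℕ r) * pairTerm (toℕ p) (toℕ r) (toℕ q)
  pairIndicator≡ p r q =
    trans (𝟙-× (suc (toℕ p) ≟ toℕ r) _) (cong (𝟙 (suc (toℕ p) ≟ toℕ r) *_)
      (trans (𝟙-× (toℕ p <? toℕ q) _) (cong (𝟙 (toℕ p <? toℕ q) *_)
        (trans (𝟙-× (val σ r <? val σ q) (val σ q <? val σ p))
          (cong₂ _*_ (cong₂ (λ x y → 𝟙 (x <? y)) (values-val r) (values-val q))
                     (cong₂ (λ x y → 𝟙 (x <? y)) (values-val q) (values-val p)))))))

  -- For fixed p, summing over r and q: the delta on r = p+1 leaves between p.
  pairRow : ∀ p → sum (map (λ r → sum (map (pairIndicator p r) (allFin n))) (allFin n))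
                    ≡ guarded between (toℕ p)
  pairRow p = begin
      sum (map (λ r → sum (map (pairIndicator p r) (allFin n))) (allFin n))
        ≡⟨ sum-allFin n _ _ (λ r → sum-allFin n _ _ (pairIndicator≡ p r)) ⟩
      sumFrom 0 n (λ r → sumFrom 0 n (λ q → 𝟙 (suc (toℕ p) ≟ r) * pairTerm (toℕ p) r q))
        ≡⟨ sumFrom-cong 0 n (λ r _ _ → sumFrom-*ˡ 0 n (𝟙 (suc (toℕ p) ≟ r)) (pairTerm (toℕ p) r)) ⟩
      sumFrom 0 n (λ r → 𝟙 (suc (toℕ p) ≟ r) * sumFrom 0 n (pairTerm (toℕ p) r))
        ≡⟨ sumFrom-delta n (suc (toℕ p)) (λ r → sumFrom 0 n (pairTerm (toℕ p) r)) ⟩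
      guarded between (toℕ p) ∎
    where open ≡-Reasoning

  pairCount≡ : pairCount σ ≡ sumFrom 0 n (guarded between)
  pairCount≡ = begin
      pairCount σ
        ≡⟨ count≡sum _ (cartesianProduct (cartesianProduct (allFin n) (allFin n)) (allFin n)) ⟩
      sum (map (λ { ((p , r) , q) → pairIndicator p r q })
               (cartesianProduct (cartesianProduct (allFin n) (allFin n)) (allFin n)))
        ≡⟨ sum-cartesianProduct _ (cartesianProduct (allFin n) (allFin n)) (allFin n) ⟩
      sum (map (λ { (p , r) → sum (map (pairIndicator p r) (allFin n)) })
               (cartesianProduct (allFin n) (allFin n)))
        ≡⟨ sum-cartesianProduct _ (allFin n) (allFin n) ⟩
      sum (map (λ p → sum (map (λ r → sum (map (pairIndicator p r) (allFin n))) (allFin n))) (allFin n))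
        ≡⟨ sum-allFin n _ _ pairRow ⟩
      sumFrom 0 n (guarded between) ∎
    where open ≡-Reasoning

lemma9p4 : (n : ℕ) (σ : Perm n) → IsAlt σ →
    ihat σ ≡ (n * n) / 4 + pairCount σ
lemma9p4 n σ alt = begin
    ihat σ
      ≡⟨ ihat≡ ⟩
    sumFrom 0 n (guarded ĉ)
      ≡⟨ blocks n 0 refl ⟩
    quarterSquare n + sumFrom 0 n (guarded between)
      ≡⟨ cong₂ _+_ (quarterSquare≡ n) (sym pairCount≡) ⟩
    n * n / 4 + pairCount σ ∎
  where
  open ≡-Reasoning
  open PermutationValues σ
  open Counts n values
  open Alternating (values-descent alt) (values-ascent alt)
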